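{- Let $d\ge 2$, let $n=\binom{d}{2}$, and let $A\in\mathbb{Z}^{d\times n}$ be the vertex–arc incidence matrix of the acyclic tournament graph $G_d$. As $\mathbf{c}$ ranges over all generic cost vectors in $\mathbb{R}^n$, the minimum of the arithmetic degree of the initial ideal $in_{\mathbf{c}}(I_A)$ equals $1$.
   Context: $G_d$ is the directed graph on vertices $1,\dots,d$ with the $n=\binom d2$ arcs $(i,j)$, $1\le i<j\le d$, each directed from $i$ to $j$. Its vertex–arc incidence matrix $A$ has rows indexed by vertices and columns by arcs, the column of arc $(i,j)$ having entry $1$ in row $i$, $-1$ in row $j$ and $0$ elsewhere. Work in $k[\mathbf{x}]=k[x_{i,j}:1\le i<j\le d]$ over a field $k$, writing $\mathbf{x}^{\mathbf{u}}=\prod x_{i,j}^{u_{i,j}}$. The toric ideal is $I_A=\langle \mathbf{x}^{\mathbf{u}}-\mathbf{x}^{\mathbf{v}} : A\mathbf{u}=A\mathbf{v},\ \mathbf{u},\mathbf{v}\in\mathbb{N}^n\rangle$. A cost vector $\mathbf{c}\in\mathbb{R}^n$ is generic if for every $\mathbf{b}\in\{A\mathbf{u}:\mathbf{u}\in\mathbb{N}^n\}$ the program $\min\{\mathbf{c}\cdot\mathbf{x}: A\mathbf{x}=\mathbf{b},\ \mathbf{x}\in\mathbb{N}^n\}$ has a unique optimal solution; then $in_{\mathbf{c}}(I_A)$, the ideal generated by the $\mathbf{c}$-largest terms of elements of $I_A$, is a monomial ideal. For a monomial ideal $J\subseteq k[x_1,\dots,x_n]$, a standard pair is a pair $(\mathbf{x}^{\mathbf{a}},\sigma)$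 with $\sigma\subseteq[n]$ such that (i) $\mathrm{supp}(\mathbf{a})\cap\sigma=\emptyset$; (ii) no monomial $\mathbf{x}^{\mathbf{a}}\mathbf{x}^{\mathbf{w}}$ with $\mathrm{supp}(\mathbf{w})\subseteq\sigma$ lies in $J$; (iii) there is no other pair $(\mathbf{x}^{\mathbf{a}'},\sigma')$ satisfying (i),(ii) with $\mathbf{x}^{\mathbf{a}'}$ dividing $\mathbf{x}^{\mathbf{a}}$ and $\mathrm{supp}(\mathbf{x}^{\mathbf{a}}/\mathbf{x}^{\mathbf{a}'})\cup\sigma\subseteq\sigma'$. The arithmetic degree of $J$ is the number of its standard pairs.
   Formalization: The generic cost vectors c range over ℚ^n instead of ℝ^n. -}

module Defs where

open import Level using (Level; _⊔_; suc)
open import Data.Nat as ℕ using (ℕ; zero; _≤_)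
open import Data.Integer as ℤ using (ℤ)
open import Data.Rational as ℚ using (ℚ)
open import Data.Fin as Fin using (Fin)
open import Data.Fin.Subset using (Subset; _∈_; _∉_; _⊆_; _∪_)
open import Data.Vec as Vec using (Vec; lookup; tabulate; zipWith; foldr)
open import Data.Vec.Properties using (≡-dec)
open import Data.List as List using (List; []; _∷_; length; concatMap; allFin)
import Data.List.Membership.Propositional as LMem
open import Data.List.Relation.Unary.Unique.Propositional using (Unique)
open import Data.Product using (Σ; ∃; _×_; _,_; proj₁; proj₂)
open import Data.Bool using (Bool; true; false; if_then_else_)
open import Relation.Nullary using (¬_; Dec; yes; no; does)
open import Relation.Binary.PropositionalEquality using (_≡_; _≢_)
open import Algebra.Bundles using (CommutativeRing)
open import Function.Bundles using (_⇔_)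

record Field (c ℓ : Level) : Set (suc (c ⊔ ℓ)) where
  field
    commutativeRing : CommutativeRing c ℓ
  open CommutativeRing commutativeRing public
  field
    0≉1     : ¬ (0# ≈ 1#)
    inverse : ∀ x → ¬ (x ≈ 0#) → ∃ λ y → (x * y) ≈ 1#

-- Exponent vectors (monomials x^u) in n variables.

Mon : ℕ → Set
Mon n = Vec ℕ n

_+ᵐ_ : ∀ {n} → Mon n → Mon n → Mon n
_+ᵐ_ = zipWith ℕ._+_

_∣ᵐ_ : ∀ {n} → Mon n → Mon n → Set
_∣ᵐ_ {n} a b = ∀ (i : Fin n) → lookup a i ≤ lookup b i

SuppIn : ∀ {n} → Mon n → Subset n → Set
SuppIn {n} u σ = ∀ (i : Fin n) → lookup u i ≢ 0 → i ∈ σ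

Matrix : ℕ → ℕ → Set
Matrix m n = Fin m → Fin n → ℤ

sumℤ : ∀ {n} → Vec ℤ n → ℤ
sumℤ = foldr _ ℤ._+_ (ℤ.+ 0)

apply : ∀ {m n} → Matrix m n → Mon n → Vec ℤ m
apply {m} {n} A u = tabulate λ r → sumℤ (tabulate λ i → A r i ℤ.* ℤ.+ (lookup u i))

sumℚ : ∀ {n} → Vec ℚ n → ℚ
sumℚ = foldr _ ℚ._+_ ℚ.0ℚ

cost : ∀ {n} → Vec ℚ n → Mon n → ℚ
cost {n} c u = sumℚ (tabulate λ i → lookup c i ℚ.* (ℤ.+ (lookup u i) ℚ./ 1))

Generic : ∀ {m n} → Matrix m n → Vec ℚ n → Set
Generic A c = ∀ u → ∃ λ u* → apply A u* ≡ apply A u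
  × (∀ v → apply A v ≡ apply A u → v ≢ u* → cost c u* ℚ.< cost c v)

-- Polynomials over a field k in n variables, as finite lists of terms
-- (coefficient, exponent); equality is coefficientwise.

module Poly {c ℓ : Level} (k : Field c ℓ) (n : ℕ) where
  open Field k

  Poly : Set c
  Poly = List (Carrier × Mon n)

  coeff : Poly → Mon n → Carrier
  coeff [] e = 0#
  coeff ((a , u) ∷ p) e = if does (≡-dec Data.Nat._≟_ u e) then a + coeff p e else coeff p e
    where import Data.Nat

  _≈P_ : Poly → Poly → Set ℓ
  p ≈P q = ∀ e → coeff p e ≈ coeff q e

  _+P_ : Poly → Poly → Poly
  _+P_ = List._++_

  _*P_ : Poly → Poly → Poly
  p *P q = concatMap (λ t → List.map (λ s → (proj₁ t * proj₁ s , proj₂ t +ᵐ proj₂ s)) q) p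

  mono : Mon n → Poly
  mono u = (1# , u) ∷ []

  binom : Mon n → Mon n → Poly
  binom u v = (1# , u) ∷ (- 1# , v) ∷ []

  sumP : List Poly → Poly
  sumP = List.foldr _+P_ []

  InIdeal : ∀ {s} → (Poly → Set s) → Poly → Set (c ⊔ ℓ ⊔ s)
  InIdeal S f = ∃ λ (gs : List (Poly × Σ Poly S)) →
    f ≈P sumP (List.map (λ t → proj₁ t *P proj₁ (proj₂ t)) gs)

  ToricGen : ∀ {m} → Matrix m n → Poly → Set c
  ToricGen A g = ∃ λ u → ∃ λ v → apply A u ≡ apply A v × g ≡ binom u v

  InToric : ∀ {m} → Matrix m n → Poly → Set (c ⊔ ℓ)
  InToric A = InIdeal (ToricGen A)

  -- g = in_c(f): the sum of the terms of f of largest c-cost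
  -- (f must be nonzero)
  IsInitialForm : Vec ℚ n → Poly → Poly → Set ℓ
  IsInitialForm cv f g = ∃ λ (M : ℚ) →
      (∀ e → ¬ (coeff f e ≈ 0#) → cost cv e ℚ.≤ M)
    × (∃ λ e → ¬ (coeff f e ≈ 0#) × cost cv e ≡ M)
    × (∀ e → cost cv e ≡ M → coeff g e ≈ coeff f e)
    × (∀ e → cost cv e ≢ M → coeff g e ≈ 0#)

  InitGen : ∀ {m} → Matrix m n → Vec ℚ n → Poly → Set (c ⊔ ℓ)
  InitGen A cv g = ∃ λ f → InToric A f × IsInitialForm cv f g

  InInitialIdeal : ∀ {m} → Matrix m n → Vec ℚ n → Mon n → Set (c ⊔ ℓ)
  InInitialIdeal A cv w = InIdeal (InitGen A cv) (mono w)

-- Standard pairs and arithmetic degree of a monomial ideal J, given by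
-- the predicate "x^u ∈ J" on exponent vectors.

module _ {n : ℕ} {s : Level} (J : Mon n → Set s) where

  Admissible : Mon n × Subset n → Set s
  Admissible (a , σ) =
      (∀ (i : Fin n) → lookup a i ≢ 0 → i ∉ σ)
    × (∀ w → SuppIn w σ → ¬ J (a +ᵐ w))

  StandardPair : Mon n × Subset n → Set s
  StandardPair (a , σ) = Admissible (a , σ) ×
    ¬ (∃ λ a' → ∃ λ σ' → Admissible (a' , σ') × (a' , σ') ≢ (a , σ)
         × a' ∣ᵐ a
         × (∃ λ r → a' +ᵐ r ≡ a × (∀ i → lookup r i ≢ 0 → i ∈ σ') × σ ⊆ σ'))

  ArithDeg : ℕ → Set s
  ArithDeg m = ∃ λ (L : List (Mon n × Subset n)) →
    Unique L × length L ≡ m × (∀ p → StandardPair p ⇔ p LMem.∈ L)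

-- The acyclic tournament G_d: arcs (i , j), i < j, listed lexicographically;
-- n = number of arcs = binom d 2.

arcs : (d : ℕ) → List (Fin d × Fin d)
arcs d = concatMap (λ i → concatMap (λ j → if does (Fin.toℕ i ℕ.<? Fin.toℕ j) then (i , j) ∷ [] else []) (allFin d)) (allFin d)

numArcs : ℕ → ℕ
numArcs d = length (arcs d)

arc : (d : ℕ) → Fin (numArcs d) → Fin d × Fin d
arc d = List.lookup (arcs d)

incidence : (d : ℕ) → Matrix d (numArcs d)
incidence d v e with arc d e
... | (i , j) = if does (v Fin.≟ i) then ℤ.+ 1
                else if does (v Fin.≟ j) then ℤ.- ℤ.+ 1 else ℤ.+ 0

-- Let c cost 0 on the arcs (j , j + 1) of the Hamiltonian path and 1 on all other arcs.
-- A monomial supported on the path is determined by its image under A (its exponents are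
-- the flows across the cuts between j and j + 1), and replacing every arc (i , j) by the
-- path i → i + 1 → ⋯ → j puts such a monomial into every fibre.  So c is generic, the
-- optimum of a fibre being its path-supported member; in_c(I_A) contains x_e for every
-- other arc e (the leading term of x_e − x^path(e)) but no path-supported monomial, hence
-- it is generated by variables and (1 , path arcs) is its only standard pair.  For an
-- arbitrary c, A is pointed, so 0 is alone in its fibre, 1 ∉ in_c(I_A), and a maximal
-- admissible pair (1 , σ) is a standard pair.

module Submission where

open import Defs
open import Level using (Level; _⊔_)
open import Function using (_∘_; case_of_)
open import Function.Bundles using (Equivalence; mk⇔)
open import Data.Empty using (⊥; ⊥-elim)
open import Data.Unit using (⊤; tt)
open import Data.Bool using (Bool; true; false; if_then_else_; _∧_; not; T)
import Data.Bool as Bool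
open import Data.Bool.Properties using (∧-zeroʳ)
open import Data.Product using (Σ; ∃; _×_; _,_; proj₁; proj₂)
import Data.Product.Properties as PP
open import Data.Sum using (_⊎_; inj₁; inj₂)
open import Data.Nat using (ℕ; _≤_)
import Data.Nat as ℕ
import Data.Nat.Properties as ℕP
import Data.Integer as ℤ
import Data.Integer.Properties as ℤP
open import Data.Integer.Tactic.RingSolver using (solve-∀)
open import Data.Rational using (ℚ)
import Data.Rational as ℚ
import Data.Rational.Properties as ℚP
open import Data.Fin as Fin using (Fin; zero; suc; toℕ)
import Data.Fin.Properties as FinP
open import Data.Fin.Subset as S using (Subset; _⊆_; _⊂_)
import Data.Fin.Subset.Properties as SP
open import Data.Fin.Subset.Induction using (⊃-wellFounded; Acc; acc)
open import Data.Vec using (Vec; []; _∷_; lookup; tabulate; zipWith; replicate)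
import Data.Vec.Properties as VP
open import Data.List as L using (List; []; _∷_; deduplicate)
import Data.List.Properties as LP
open import Data.List.Membership.Propositional using (_∈_)
open import Data.List.Membership.Propositional.Properties
  using (∈-++⁺ˡ; ∈-++⁺ʳ; ∈-deduplicate⁺; ∈-lookup; ∈-filter⁺; ∈-filter⁻; ∈-cartesianProduct⁺; ∈-allFin)
open import Data.List.Relation.Unary.All using ([])
open import Data.List.Relation.Unary.All.Properties using (All¬⇒¬Any)
open import Data.List.Relation.Unary.Any using (here; there)
import Data.List.Relation.Unary.Any as Any
import Data.List.Relation.Unary.Any.Properties as AnyP
open import Data.List.Relation.Unary.AllPairs using ([]; _∷_)
open import Data.List.Relation.Unary.Unique.Propositional using (Unique)
import Data.List.Relation.Unary.Unique.Propositional.Properties as Uniq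
open import Data.List.Relation.Unary.Unique.DecPropositional.Properties using (deduplicate-!)
import Algebra.Properties.CommutativeSemigroup as CSP
open import Relation.Nullary using (¬_; Dec; yes; no; does)
open import Relation.Nullary.Negation using (¬¬-map)
open import Relation.Nullary.Decidable using (dec-true; dec-false; decidable-stable; ¬?; _×-dec_)
open import Relation.Binary.PropositionalEquality
  using (_≡_; _≢_; refl; sym; trans; cong; cong₂; subst; subst₂; module ≡-Reasoning)

-- Monomials

0ᵐ : ∀ {n} → Mon n
0ᵐ = replicate _ 0

unit : ∀ {n} → Fin n → Mon n
unit zero = 1 ∷ 0ᵐ
unit (suc i) = 0 ∷ unit i

lookup-ext : ∀ {n} {A : Set} {xs ys : Vec A n} → (∀ i → lookup xs i ≡ lookup ys i) → xs ≡ ys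
lookup-ext {xs = xs} {ys} p = begin
  xs                    ≡⟨ VP.tabulate∘lookup xs ⟨
  tabulate (lookup xs)  ≡⟨ VP.tabulate-cong p ⟩
  tabulate (lookup ys)  ≡⟨ VP.tabulate∘lookup ys ⟩
  ys                    ∎
  where open ≡-Reasoning

lookup-+ᵐ : ∀ {n} (u v : Mon n) i → lookup (u +ᵐ v) i ≡ lookup u i ℕ.+ lookup v i
lookup-+ᵐ u v i = VP.lookup-zipWith ℕ._+_ i u v

lookup-0ᵐ : ∀ {n} (i : Fin n) → lookup (0ᵐ {n}) i ≡ 0
lookup-0ᵐ i = VP.lookup-replicate i 0

lookup-unit-≡ : ∀ {n} (e : Fin n) → lookup (unit e) e ≡ 1
lookup-unit-≡ zero = refl
lookup-unit-≡ (suc e) = lookup-unit-≡ e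

lookup-unit-≢ : ∀ {n} {e i : Fin n} → i ≢ e → lookup (unit e) i ≡ 0
lookup-unit-≢ {e = zero} {zero} i≢e = ⊥-elim (i≢e refl)
lookup-unit-≢ {e = zero} {suc i} _ = lookup-0ᵐ i
lookup-unit-≢ {e = suc e} {zero} _ = refl
lookup-unit-≢ {e = suc e} {suc i} i≢e = lookup-unit-≢ (i≢e ∘ cong suc)

lookup-unit-≢0 : ∀ {n} (i : Fin n) → lookup (unit i) i ≢ 0
lookup-unit-≢0 i eq = ℕP.1+n≢0 (trans (sym (lookup-unit-≡ i)) eq)

unit-support : ∀ {n} (e i : Fin n) → lookup (unit e) i ≢ 0 → i ≡ e
unit-support e i nz with i Fin.≟ e
... | yes i≡e = i≡e
... | no i≢e = ⊥-elim (nz (lookup-unit-≢ i≢e))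

+ᵐ-identityˡ : ∀ {n} (u : Mon n) → 0ᵐ +ᵐ u ≡ u
+ᵐ-identityˡ = VP.zipWith-identityˡ ℕP.+-identityˡ

+ᵐ-identityʳ : ∀ {n} (u : Mon n) → u +ᵐ 0ᵐ ≡ u
+ᵐ-identityʳ = VP.zipWith-identityʳ ℕP.+-identityʳ

+ᵐ-support : ∀ {n} (u v : Mon n) i → lookup (u +ᵐ v) i ≢ 0 → lookup u i ≢ 0 ⊎ lookup v i ≢ 0
+ᵐ-support u v i nz with lookup u i ℕ.≟ 0
... | no uᵢ≢0 = inj₁ uᵢ≢0
... | yes uᵢ≡0 = inj₂ λ vᵢ≡0 → nz (trans (lookup-+ᵐ u v i) (cong₂ ℕ._+_ uᵢ≡0 vᵢ≡0))

+ᵐ-supportʳ : ∀ {n} (u v : Mon n) i → lookup v i ≢ 0 → lookup (u +ᵐ v) i ≢ 0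
+ᵐ-supportʳ u v i vᵢ≢0 eq = vᵢ≢0 (ℕP.m+n≡0⇒n≡0 (lookup u i) (trans (sym (lookup-+ᵐ u v i)) eq))

+ᵐ-unit-support : ∀ {n} (u : Mon n) i → lookup (u +ᵐ unit i) i ≢ 0
+ᵐ-unit-support u i = +ᵐ-supportʳ u (unit i) i (lookup-unit-≢0 i)

+ᵐ-comm : ∀ {n} (u v : Mon n) → u +ᵐ v ≡ v +ᵐ u
+ᵐ-comm = VP.zipWith-comm ℕP.+-comm

unit-nonzero : ∀ {n} (i : Fin n) → unit i ≢ 0ᵐ
unit-nonzero i eq = lookup-unit-≢0 i (trans (cong (λ u → lookup u i) eq) (lookup-0ᵐ i))

+ᵐ≡0ᵐ⇒≡0ᵐ : ∀ {n} (a u : Mon n) → a +ᵐ u ≡ 0ᵐ → u ≡ 0ᵐ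
+ᵐ≡0ᵐ⇒≡0ᵐ a u eq = lookup-ext λ i → trans
  (ℕP.m+n≡0⇒n≡0 (lookup a i) (trans (sym (lookup-+ᵐ a u i)) (trans (cong (λ w → lookup w i) eq) (lookup-0ᵐ i))))
  (sym (lookup-0ᵐ i))

∣ᵐ0ᵐ⇒≡0ᵐ : ∀ {n} (a : Mon n) → a ∣ᵐ 0ᵐ → a ≡ 0ᵐ
∣ᵐ0ᵐ⇒≡0ᵐ a a∣0 = lookup-ext λ i → trans (ℕP.n≤0⇒n≡0 (subst (lookup a i ≤_) (lookup-0ᵐ i) (a∣0 i))) (sym (lookup-0ᵐ i))

0ᵐ∣ᵐ : ∀ {n} (a : Mon n) → 0ᵐ ∣ᵐ a
0ᵐ∣ᵐ a i = subst (_≤ lookup a i) (sym (lookup-0ᵐ i)) ℕ.z≤n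

unit-∣ᵐ : ∀ {n} (w : Mon n) e → lookup w e ≢ 0 → unit e ∣ᵐ w
unit-∣ᵐ w e nz i with i Fin.≟ e
... | yes refl = subst (_≤ lookup w e) (sym (lookup-unit-≡ e)) (ℕP.n≢0⇒n>0 nz)
... | no i≢e = subst (_≤ lookup w i) (sym (lookup-unit-≢ i≢e)) ℕ.z≤n

_∸ᵐ_ : ∀ {n} → Mon n → Mon n → Mon n
_∸ᵐ_ = zipWith ℕ._∸_

∸ᵐ-+ᵐ : ∀ {n} {u w : Mon n} → u ∣ᵐ w → (w ∸ᵐ u) +ᵐ u ≡ w
∸ᵐ-+ᵐ {u = u} {w} u∣w = lookup-ext λ i → begin
  lookup ((w ∸ᵐ u) +ᵐ u) i           ≡⟨ lookup-+ᵐ (w ∸ᵐ u) u i ⟩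
  lookup (w ∸ᵐ u) i ℕ.+ lookup u i   ≡⟨ cong (ℕ._+ lookup u i) (VP.lookup-zipWith ℕ._∸_ i w u) ⟩
  lookup w i ℕ.∸ lookup u i ℕ.+ lookup u i ≡⟨ ℕP.m∸n+n≡m (u∣w i) ⟩
  lookup w i                         ∎
  where open ≡-Reasoning

mon-induction : ∀ {ℓ n} (S : Fin n → Set) (P : Mon n → Set ℓ) →
  P 0ᵐ → (∀ u i → S i → P u → P (u +ᵐ unit i)) →
  ∀ u → (∀ i → lookup u i ≢ 0 → S i) → P u
mon-induction {n = ℕ.zero} S P base step [] _ = base
mon-induction {n = ℕ.suc n} S P base step (x ∷ u) supp = go x (supp zero)
  where
  tail-case : P (0 ∷ u)
  tail-case = mon-induction (S ∘ suc) (P ∘ (0 ∷_)) base (λ v i → step (0 ∷ v) (suc i)) u (supp ∘ suc)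
  go : ∀ y → (y ≢ 0 → S zero) → P (y ∷ u)
  go ℕ.zero _ = tail-case
  go (ℕ.suc y) S₀ = subst P (cong₂ _∷_ (ℕP.+-comm y 1) (+ᵐ-identityʳ u))
    (step (y ∷ u) zero (S₀ (λ ())) (go y λ _ → S₀ (λ ())))

-- The linear map u ↦ A u

sumℤ-0 : ∀ {n} (f : Fin n → ℤ.ℤ) → (∀ i → f i ≡ ℤ.0ℤ) → sumℤ (tabulate f) ≡ ℤ.0ℤ
sumℤ-0 {ℕ.zero} f f≡0 = refl
sumℤ-0 {ℕ.suc n} f f≡0 = cong₂ ℤ._+_ (f≡0 zero) (sumℤ-0 (f ∘ suc) (f≡0 ∘ suc))

sumℤ-+ : ∀ {n} (f g : Fin n → ℤ.ℤ) →
  sumℤ (tabulate λ i → f i ℤ.+ g i) ≡ sumℤ (tabulate f) ℤ.+ sumℤ (tabulate g)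
sumℤ-+ {ℕ.zero} f g = refl
sumℤ-+ {ℕ.suc n} f g = trans (cong (λ s → f zero ℤ.+ g zero ℤ.+ s) (sumℤ-+ (f ∘ suc) (g ∘ suc)))
  (CSP.interchange ℤP.+-commutativeSemigroup (f zero) (g zero) _ _)

sumℤ-unit : ∀ {n} (f : Fin n → ℤ.ℤ) e → sumℤ (tabulate λ i → f i ℤ.* ℤ.+ lookup (unit e) i) ≡ f e
sumℤ-unit f zero = trans (cong₂ ℤ._+_ (ℤP.*-identityʳ (f zero))
    (sumℤ-0 _ λ i → trans (cong (λ x → f (suc i) ℤ.* ℤ.+ x) (lookup-0ᵐ i)) (ℤP.*-zeroʳ (f (suc i)))))
  (ℤP.+-identityʳ (f zero))
sumℤ-unit f (suc e) = trans (cong₂ ℤ._+_ (ℤP.*-zeroʳ (f zero)) (sumℤ-unit (f ∘ suc) e)) (ℤP.+-identityˡ (f (suc e)))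

module _ {m n : ℕ} (A : Matrix m n) where

  row : Mon n → Fin m → ℤ.ℤ
  row u r = sumℤ (tabulate λ i → A r i ℤ.* ℤ.+ lookup u i)

  row≡⇒apply≡ : ∀ {u v} → (∀ r → row u r ≡ row v r) → apply A u ≡ apply A v
  row≡⇒apply≡ = VP.tabulate-cong

  apply≡⇒row≡ : ∀ {u v} → apply A u ≡ apply A v → ∀ r → row u r ≡ row v r
  apply≡⇒row≡ {u} {v} eq r = begin
    row u r               ≡⟨ VP.lookup∘tabulate (row u) r ⟨
    lookup (apply A u) r  ≡⟨ cong (λ b → lookup b r) eq ⟩
    lookup (apply A v) r  ≡⟨ VP.lookup∘tabulate (row v) r ⟩
    row v r               ∎
    where open ≡-Reasoning

  row-0ᵐ : ∀ r → row 0ᵐ r ≡ ℤ.0ℤ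
  row-0ᵐ r = sumℤ-0 _ λ i → trans (cong (λ x → A r i ℤ.* ℤ.+ x) (lookup-0ᵐ i)) (ℤP.*-zeroʳ (A r i))

  row-unit : ∀ e r → row (unit e) r ≡ A r e
  row-unit e r = sumℤ-unit (A r) e

  row-+ᵐ : ∀ u v r → row (u +ᵐ v) r ≡ row u r ℤ.+ row v r
  row-+ᵐ u v r = trans (cong sumℤ (VP.tabulate-cong λ i →
      trans (cong (λ x → A r i ℤ.* ℤ.+ x) (lookup-+ᵐ u v i)) (ℤP.*-distribˡ-+ (A r i) _ _)))
    (sumℤ-+ (λ i → A r i ℤ.* ℤ.+ lookup u i) (λ i → A r i ℤ.* ℤ.+ lookup v i))

  apply-+ᵐ-cong : ∀ {u u′ v v′} → apply A u ≡ apply A v → apply A u′ ≡ apply A v′ →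
    apply A (u +ᵐ u′) ≡ apply A (v +ᵐ v′)
  apply-+ᵐ-cong {u} {u′} {v} {v′} eq eq′ = row≡⇒apply≡ {u +ᵐ u′} {v +ᵐ v′} λ r → begin
    row (u +ᵐ u′) r       ≡⟨ row-+ᵐ u u′ r ⟩
    row u r ℤ.+ row u′ r  ≡⟨ cong₂ ℤ._+_ (apply≡⇒row≡ {u} {v} eq r) (apply≡⇒row≡ {u′} {v′} eq′ r) ⟩
    row v r ℤ.+ row v′ r  ≡⟨ row-+ᵐ v v′ r ⟨
    row (v +ᵐ v′) r       ∎
    where open ≡-Reasoning

Optimal : ∀ {m n} → Matrix m n → Vec ℚ n → Mon n → Set
Optimal A cv b = ∀ v → apply A v ≡ apply A b → v ≢ b → cost cv b ℚ.< cost cv v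

-- Polynomials: sums of coefficients over sets of exponents

T-does : ∀ {p} {P : Set p} (P? : Dec P) → T (does P?) → P
T-does (yes p) _ = p

¬¬-zipWith : ∀ {a b c} {A : Set a} {B : Set b} {C : Set c} → (A → B → C) → ¬ ¬ A → ¬ ¬ B → ¬ ¬ C
¬¬-zipWith f ¬¬a ¬¬b ¬c = ¬¬a λ a → ¬¬b λ b → ¬c (f a b)

module PolynomialFacts {c ℓ : Level} (k : Field c ℓ) (n : ℕ) where
  open Field k renaming (refl to ≈-refl; sym to ≈-sym; trans to ≈-trans) hiding (zero)
  open Poly k n
  open import Relation.Binary.Reasoning.Setoid setoid
  module +-CS = CSP +-commutativeSemigroup

  _≟ᵐ_ : (u v : Mon n) → Dec (u ≡ v)
  _≟ᵐ_ = VP.≡-dec ℕ._≟_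

  _≡ᵇ_ : Mon n → Mon n → Bool
  u ≡ᵇ e = does (u ≟ᵐ e)

  [_]·_ : Bool → Carrier → Carrier
  [ b ]· x = if b then x else 0#

  []·-0# : ∀ b → [ b ]· 0# ≈ 0#
  []·-0# true = ≈-refl
  []·-0# false = ≈-refl

  []·-+ : ∀ b x y → [ b ]· (x + y) ≈ [ b ]· x + [ b ]· y
  []·-+ true x y = ≈-refl
  []·-+ false x y = ≈-sym (+-identityˡ 0#)

  []·-cong : ∀ b {x y} → x ≈ y → [ b ]· x ≈ [ b ]· y
  []·-cong true x≈y = x≈y
  []·-cong false x≈y = ≈-refl

  if-+ : ∀ b x y → (if b then x + y else y) ≈ [ b ]· x + y
  if-+ true x y = ≈-refl
  if-+ false x y = ≈-sym (+-identityˡ y)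

  Σcoeff : (Mon n → Bool) → Poly → Carrier
  Σcoeff P [] = 0#
  Σcoeff P ((a , u) ∷ p) = if P u then a + Σcoeff P p else Σcoeff P p

  coeff≡Σcoeff : ∀ p e → coeff p e ≡ Σcoeff (_≡ᵇ e) p
  coeff≡Σcoeff [] e = refl
  coeff≡Σcoeff ((a , u) ∷ p) e = cong (λ s → if does (u ≟ᵐ e) then a + s else s) (coeff≡Σcoeff p e)

  Σcoeff-cong : ∀ {P Q} → (∀ u → P u ≡ Q u) → ∀ p → Σcoeff P p ≡ Σcoeff Q p
  Σcoeff-cong P≗Q [] = refl
  Σcoeff-cong P≗Q ((a , u) ∷ p) rewrite P≗Q u | Σcoeff-cong P≗Q p = refl

  Σcoeff-++ : ∀ P p q → Σcoeff P (p L.++ q) ≈ Σcoeff P p + Σcoeff P q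
  Σcoeff-++ P [] q = ≈-sym (+-identityˡ _)
  Σcoeff-++ P ((a , u) ∷ p) q with P u
  ... | true = ≈-trans (+-cong ≈-refl (Σcoeff-++ P p q)) (≈-sym (+-assoc _ _ _))
  ... | false = Σcoeff-++ P p q

  Σcoeff-split : ∀ (P Q : Mon n → Bool) p → Σcoeff P p ≈ Σcoeff (λ u → P u ∧ Q u) p + Σcoeff (λ u → P u ∧ not (Q u)) p
  Σcoeff-split P Q [] = ≈-sym (+-identityˡ 0#)
  Σcoeff-split P Q ((a , u) ∷ p) with P u | Q u
  ... | true | true = ≈-trans (+-cong ≈-refl (Σcoeff-split P Q p)) (≈-sym (+-assoc _ _ _))
  ... | true | false = ≈-trans (+-cong ≈-refl (Σcoeff-split P Q p)) (+-CS.x∙yz≈y∙xz a _ _)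
  ... | false | _ = Σcoeff-split P Q p

  scale : Carrier → Mon n → Carrier × Mon n → Carrier × Mon n
  scale α a s = α * proj₁ s , a +ᵐ proj₂ s

  Σcoeff-scale : ∀ P α a g → Σcoeff P (L.map (scale α a) g) ≈ α * Σcoeff (P ∘ (a +ᵐ_)) g
  Σcoeff-scale P α a [] = ≈-sym (zeroʳ α)
  Σcoeff-scale P α a ((β , b) ∷ g) with P (a +ᵐ b)
  ... | true = ≈-trans (+-cong ≈-refl (Σcoeff-scale P α a g)) (≈-sym (distribˡ α β _))
  ... | false = Σcoeff-scale P α a g

  sumOver : List (Mon n) → (Mon n → Carrier) → Carrier
  sumOver [] F = 0#
  sumOver (e ∷ E) F = F e + sumOver E F

  sumOver-cong : ∀ E {F G} → (∀ e → F e ≈ G e) → sumOver E F ≈ sumOver E G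
  sumOver-cong [] F≈G = ≈-refl
  sumOver-cong (e ∷ E) F≈G = +-cong (F≈G e) (sumOver-cong E F≈G)

  sumOver-+ : ∀ E F G → sumOver E (λ e → F e + G e) ≈ sumOver E F + sumOver E G
  sumOver-+ [] F G = ≈-sym (+-identityˡ 0#)
  sumOver-+ (e ∷ E) F G = ≈-trans (+-cong ≈-refl (sumOver-+ E F G)) (+-CS.interchange _ _ _ _)

  sumOver-0# : ∀ E {F} → (∀ e → e ∈ E → F e ≈ 0#) → sumOver E F ≈ 0#
  sumOver-0# [] F≈0 = ≈-refl
  sumOver-0# (e ∷ E) F≈0 = ≈-trans (+-cong (F≈0 e (here refl)) (sumOver-0# E (λ e′ → F≈0 e′ ∘ there))) (+-identityˡ 0#)

  sumOver-indicator : ∀ {E u} → Unique E → u ∈ E → ∀ x → sumOver E (λ e → [ u ≡ᵇ e ]· x) ≈ x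
  sumOver-indicator {e ∷ E} (e∉E ∷ uniq) (here refl) x rewrite dec-true (e ≟ᵐ e) refl =
    ≈-trans (+-cong ≈-refl (sumOver-0# E λ e′ e′∈E →
      reflexive (cong ([_]· x) (dec-false (e ≟ᵐ e′) λ { refl → All¬⇒¬Any e∉E e′∈E })))) (+-identityʳ x)
  sumOver-indicator {e ∷ E} {u} (e∉E ∷ uniq) (there u∈E) x rewrite dec-false (u ≟ᵐ e) (λ { refl → All¬⇒¬Any e∉E u∈E }) =
    ≈-trans (+-identityˡ _) (sumOver-indicator uniq u∈E x)

  -- Σcoeff is computed term by term while ≈P compares coefficients; a duplicate-free list
  -- containing all exponents mediates between the two.
  Σcoeff-as-sumOver : ∀ P p {E} → Unique E → (∀ {u} → u ∈ L.map proj₂ p → u ∈ E) →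
    Σcoeff P p ≈ sumOver E (λ e → [ P e ]· coeff p e)
  Σcoeff-as-sumOver P [] {E} _ _ = ≈-sym (sumOver-0# E λ e _ → []·-0# (P e))
  Σcoeff-as-sumOver P ((a , u) ∷ p) {E} uniq p⊆E = begin
    (if P u then a + Σcoeff P p else Σcoeff P p)
      ≈⟨ if-+ (P u) a _ ⟩
    [ P u ]· a + Σcoeff P p
      ≈⟨ +-cong (≈-sym (sumOver-indicator uniq (p⊆E (here refl)) _)) (Σcoeff-as-sumOver P p uniq (p⊆E ∘ there)) ⟩
    sumOver E (λ e → [ u ≡ᵇ e ]· ([ P u ]· a)) + sumOver E (λ e → [ P e ]· coeff p e)
      ≈⟨ sumOver-+ E _ _ ⟨
    sumOver E (λ e → [ u ≡ᵇ e ]· ([ P u ]· a) + [ P e ]· coeff p e)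
      ≈⟨ sumOver-cong E summand ⟩
    sumOver E (λ e → [ P e ]· coeff ((a , u) ∷ p) e)
      ∎
    where
    summand : ∀ e → [ u ≡ᵇ e ]· ([ P u ]· a) + [ P e ]· coeff p e ≈ [ P e ]· coeff ((a , u) ∷ p) e
    summand e with u ≟ᵐ e
    ... | yes refl = ≈-sym ([]·-+ (P u) a (coeff p u))
    ... | no _ = +-identityˡ _

  private
    support : Poly → Poly → List (Mon n)
    support p q = deduplicate _≟ᵐ_ (L.map proj₂ p L.++ L.map proj₂ q)

    support-unique : ∀ p q → Unique (support p q)
    support-unique p q = deduplicate-! _≟ᵐ_ _

  Σcoeff-resp-≈P : ∀ P p q → p ≈P q → Σcoeff P p ≈ Σcoeff P q
  Σcoeff-resp-≈P P p q p≈q = begin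
    Σcoeff P p                           ≈⟨ Σcoeff-as-sumOver P p (support-unique p q) (∈-deduplicate⁺ _≟ᵐ_ ∘ ∈-++⁺ˡ) ⟩
    sumOver E (λ e → [ P e ]· coeff p e) ≈⟨ sumOver-cong E (λ e → []·-cong (P e) (p≈q e)) ⟩
    sumOver E (λ e → [ P e ]· coeff q e) ≈⟨ Σcoeff-as-sumOver P q (support-unique p q) (∈-deduplicate⁺ _≟ᵐ_ ∘ ∈-++⁺ʳ _) ⟨
    Σcoeff P q                           ∎
    where
    E : List (Mon n)
    E = support p q

  -- Equality in k need not be decidable, so vanishing of coefficients is only obtained
  -- under ¬ ¬; that suffices, since membership of monomials in in_c(I_A) is only refuted.
  ¬¬-sumOver≈0# : ∀ E {F} → (∀ e → ¬ ¬ F e ≈ 0#) → ¬ ¬ sumOver E F ≈ 0#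
  ¬¬-sumOver≈0# [] _ ¬0≈0 = ¬0≈0 ≈-refl
  ¬¬-sumOver≈0# (e ∷ E) F≈0 = ¬¬-zipWith (λ x y → ≈-trans (+-cong x y) (+-identityˡ 0#)) (F≈0 e) (¬¬-sumOver≈0# E F≈0)

  ¬¬-Σcoeff≈0# : ∀ P p → (∀ u → T (P u) → ¬ ¬ coeff p u ≈ 0#) → ¬ ¬ Σcoeff P p ≈ 0#
  ¬¬-Σcoeff≈0# P p coeff≈0 = ¬¬-map (≈-trans (Σcoeff-as-sumOver P p (support-unique p []) (∈-deduplicate⁺ _≟ᵐ_ ∘ ∈-++⁺ˡ)))
    (¬¬-sumOver≈0# (support p []) summand)
    where
    summand : ∀ e → ¬ ¬ [ P e ]· coeff p e ≈ 0#
    summand e with P e | coeff≈0 e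
    ... | true | ¬¬coeff≈0 = ¬¬coeff≈0 _
    ... | false | _ = λ ¬0≈0 → ¬0≈0 ≈-refl

  Σcoeff-mono-*P : ∀ P a q → Σcoeff P (mono a *P q) ≈ Σcoeff (P ∘ (a +ᵐ_)) q
  Σcoeff-mono-*P P a q = begin
    Σcoeff P (L.map (scale 1# a) q L.++ [])         ≈⟨ Σcoeff-++ P (L.map (scale 1# a) q) [] ⟩
    Σcoeff P (L.map (scale 1# a) q) + 0#            ≈⟨ +-identityʳ _ ⟩
    Σcoeff P (L.map (scale 1# a) q)                 ≈⟨ Σcoeff-scale P 1# a q ⟩
    1# * Σcoeff (P ∘ (a +ᵐ_)) q                     ≈⟨ *-identityˡ _ ⟩
    Σcoeff (P ∘ (a +ᵐ_)) q                          ∎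

  combination : ∀ {s} {S : Poly → Set s} → List (Poly × Σ Poly S) → Poly
  combination gs = sumP (L.map (λ t → proj₁ t *P proj₁ (proj₂ t)) gs)

  generator-multiple-∈ : ∀ {s} {S : Poly → Set s} {g} h → S g → InIdeal S (h *P g)
  generator-multiple-∈ {g = g} h Sg = ((h , g , Sg) ∷ []) , λ e → reflexive (cong (λ q → coeff q e) (sym (LP.++-identityʳ (h *P g))))

  *P-identityˡ : ∀ p → (mono 0ᵐ *P p) ≈P p
  *P-identityˡ p e = begin
    coeff (mono 0ᵐ *P p) e                    ≡⟨ coeff≡Σcoeff (mono 0ᵐ *P p) e ⟩
    Σcoeff (_≡ᵇ e) (mono 0ᵐ *P p)             ≈⟨ Σcoeff-mono-*P (_≡ᵇ e) 0ᵐ p ⟩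
    Σcoeff (λ u → (0ᵐ +ᵐ u) ≡ᵇ e) p           ≡⟨ Σcoeff-cong (λ u → cong (_≡ᵇ e) (+ᵐ-identityˡ u)) p ⟩
    Σcoeff (_≡ᵇ e) p                          ≡⟨ coeff≡Σcoeff p e ⟨
    coeff p e                                 ∎

  mono-self : ∀ u → coeff (mono u) u ≈ 1#
  mono-self u = ≈-trans (reflexive (cong (if_then 1# + 0# else 0#) (dec-true (u ≟ᵐ u) refl))) (+-identityʳ 1#)

  mono-other : ∀ {u e} → e ≢ u → coeff (mono u) e ≈ 0#
  mono-other {u} {e} e≢u = reflexive (cong (if_then 1# + 0# else 0#) (dec-false (u ≟ᵐ e) (e≢u ∘ sym)))

  mono-*P-mono : ∀ a b → (mono a *P mono b) ≈P mono (a +ᵐ b)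
  mono-*P-mono a b e = ≈-trans (reflexive (coeff≡Σcoeff (mono a *P mono b) e)) (Σcoeff-mono-*P (_≡ᵇ e) a (mono b))

  ¬¬-Σcoeff-ideal≈0# : ∀ {s} {S : Poly → Set s} P → (∀ h g → S g → ¬ ¬ Σcoeff P (h *P g) ≈ 0#) →
    ∀ {f} → InIdeal S f → ¬ ¬ Σcoeff P f ≈ 0#
  ¬¬-Σcoeff-ideal≈0# {S = S} P multiples≈0 {f} (gs , f≈) = ¬¬-map (≈-trans (Σcoeff-resp-≈P P f (combination gs) f≈)) (sum≈0 gs)
    where
    sum≈0 : ∀ (gs : List (Poly × Σ Poly S)) → ¬ ¬ Σcoeff P (combination gs) ≈ 0#
    sum≈0 [] ¬0≈0 = ¬0≈0 ≈-refl
    sum≈0 ((h , g , Sg) ∷ gs) = ¬¬-zipWith (λ x y → ≈-trans (Σcoeff-++ P (h *P g) (combination gs)) (≈-trans (+-cong x y) (+-identityʳ 0#)))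
      (multiples≈0 h g Sg) (sum≈0 gs)

  module InitialIdeal {m : ℕ} (A : Matrix m n) (cv : Vec ℚ n) where

    Homogeneous : (Mon n → Bool) → Set
    Homogeneous P = ∀ u v → apply A u ≡ apply A v → P u ≡ P v

    Σcoeff-binom : ∀ {P} → Homogeneous P → ∀ {u v} → apply A u ≡ apply A v → Σcoeff P (binom u v) ≈ 0#
    Σcoeff-binom {P} hom {u} {v} Au≡Av with P u | P v | hom u v Au≡Av
    ... | true | true | _ = ≈-trans (+-cong ≈-refl (+-identityʳ (- 1#))) (-‿inverseʳ 1#)
    ... | false | false | _ = ≈-refl
    ... | true | false | ()
    ... | false | true | ()

    Σcoeff-*P-binom : ∀ {P} → Homogeneous P → ∀ {u v} → apply A u ≡ apply A v → ∀ h → Σcoeff P (h *P binom u v) ≈ 0#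
    Σcoeff-*P-binom hom Au≡Av [] = ≈-refl
    Σcoeff-*P-binom {P} hom {u} {v} Au≡Av ((α , a) ∷ h) = begin
      Σcoeff P (L.map (scale α a) (binom u v) L.++ (h *P binom u v))
        ≈⟨ Σcoeff-++ P (L.map (scale α a) (binom u v)) (h *P binom u v) ⟩
      Σcoeff P (L.map (scale α a) (binom u v)) + Σcoeff P (h *P binom u v)
        ≈⟨ +-cong (Σcoeff-scale P α a (binom u v)) (Σcoeff-*P-binom hom Au≡Av h) ⟩
      α * Σcoeff (P ∘ (a +ᵐ_)) (binom u v) + 0#
        ≈⟨ +-cong (*-cong ≈-refl (Σcoeff-binom (λ x y eq → hom (a +ᵐ x) (a +ᵐ y) (apply-+ᵐ-cong A {a} {x} {a} {y} refl eq)) Au≡Av)) ≈-refl ⟩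
      α * 0# + 0#
        ≈⟨ +-identityʳ _ ⟩
      α * 0#
        ≈⟨ zeroʳ α ⟩
      0#
        ∎

    fiber? : ∀ b u → Dec (apply A u ≡ apply A b)
    fiber? b u = VP.≡-dec ℤ._≟_ (apply A u) (apply A b)

    fiber : Mon n → Mon n → Bool
    fiber b u = does (fiber? b u)

    fiber-homogeneous : ∀ b → Homogeneous (fiber b)
    fiber-homogeneous b _ _ Au≡Av = cong (λ z → does (VP.≡-dec ℤ._≟_ z (apply A b))) Au≡Av

    ¬¬-Σcoeff-toric≈0# : ∀ {P} → Homogeneous P → ∀ {f} → InToric A f → ¬ ¬ Σcoeff P f ≈ 0#
    ¬¬-Σcoeff-toric≈0# {P} hom {f} = ¬¬-Σcoeff-ideal≈0# P (λ { h _ (u , v , Au≡Av , refl) ¬≈0 → ¬≈0 (Σcoeff-*P-binom hom Au≡Av h) }) {f}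

    -- The fibre sum of f vanishes, and every other term in the fibre of b costs more than b.
    toric-vanishes-at-optimum : ∀ {f} → InToric A f → ∀ {b} → Optimal A cv b →
      (∀ e → ¬ coeff f e ≈ 0# → cost cv e ℚ.≤ cost cv b) → ¬ ¬ coeff f b ≈ 0#
    toric-vanishes-at-optimum {f} f∈I {b} b-opt ≤b =
      ¬¬-zipWith f_b≈0 (¬¬-Σcoeff-toric≈0# (fiber-homogeneous b) {f} f∈I) (¬¬-Σcoeff≈0# Others f other≈0)
      where
      Others : Mon n → Bool
      Others u = fiber b u ∧ not (u ≡ᵇ b)

      other≈0 : ∀ u → T (Others u) → ¬ ¬ coeff f u ≈ 0#
      other≈0 u = other≈0′ (fiber? b u) (u ≟ᵐ b)
        where
        other≈0′ : (Au≡Ab? : Dec (apply A u ≡ apply A b)) (u≡b? : Dec (u ≡ b)) →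
          T (does Au≡Ab? ∧ not (does u≡b?)) → ¬ ¬ coeff f u ≈ 0#
        other≈0′ (yes Au≡Ab) (no u≢b) _ ¬f_u≈0 = ℚP.<-irrefl refl (ℚP.<-≤-trans (b-opt u Au≡Ab u≢b) (≤b u ¬f_u≈0))
        other≈0′ (yes _) (yes _) ()
        other≈0′ (no _) _ ()

      fiber∧≡b : ∀ u → (fiber b u ∧ (u ≡ᵇ b)) ≡ (u ≡ᵇ b)
      fiber∧≡b u = fiber∧ (u ≟ᵐ b)
        where
        fiber∧ : (u≡b? : Dec (u ≡ b)) → (fiber b u ∧ does u≡b?) ≡ does u≡b?
        fiber∧ (yes refl) = cong (_∧ true) (dec-true (fiber? u u) refl)
        fiber∧ (no _) = ∧-zeroʳ (fiber b u)

      f_b≈0 : Σcoeff (fiber b) f ≈ 0# → Σcoeff Others f ≈ 0# → coeff f b ≈ 0#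
      f_b≈0 fiber≈0 others≈0 = begin
        coeff f b                                       ≡⟨ coeff≡Σcoeff f b ⟩
        Σcoeff (_≡ᵇ b) f                                ≡⟨ Σcoeff-cong fiber∧≡b f ⟨
        Σcoeff (λ u → fiber b u ∧ (u ≡ᵇ b)) f           ≈⟨ +-identityʳ _ ⟨
        Σcoeff (λ u → fiber b u ∧ (u ≡ᵇ b)) f + 0#      ≈⟨ +-cong ≈-refl others≈0 ⟨
        Σcoeff (λ u → fiber b u ∧ (u ≡ᵇ b)) f + Σcoeff Others f ≈⟨ Σcoeff-split (fiber b) (_≡ᵇ b) f ⟨
        Σcoeff (fiber b) f                              ≈⟨ fiber≈0 ⟩
        0#                                              ∎

    initialForm-vanishes-at-optimum : ∀ {g} → InitGen A cv g → ∀ {b} → Optimal A cv b → ¬ ¬ coeff g b ≈ 0#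
    initialForm-vanishes-at-optimum {g} (f , f∈I , M , ≤M , _ , g≈f , g≈0) {b} b-opt = at-b (cost cv b ℚ.≟ M)
      where
      at-b : Dec (cost cv b ≡ M) → ¬ ¬ coeff g b ≈ 0#
      at-b (no cost≢M) ¬g≈0 = ¬g≈0 (g≈0 b cost≢M)
      at-b (yes cost≡M) = ¬¬-map (≈-trans (g≈f b cost≡M))
        (toric-vanishes-at-optimum {f} f∈I b-opt λ e f_e≉0 → subst (cost cv e ℚ.≤_) (sym cost≡M) (≤M e f_e≉0))

    -- The coefficient of x^w in h · g is the sum of α · g(u) over the terms α x^a of h with
    -- a + u = w, and an initial form g vanishes at every fibre optimum u.
    ∉-initialIdeal : ∀ w → (∀ a u → a +ᵐ u ≡ w → Optimal A cv u) → ¬ InInitialIdeal A cv w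
    ∉-initialIdeal w cofactor-optimal w∈J =
      ¬¬-Σcoeff-ideal≈0# (_≡ᵇ w) multiples≈0 {mono w} w∈J λ w≈0 → 0≉1 (≈-trans (≈-sym w≈0) (mono-self w))
      where

      multiples≈0 : ∀ h g → InitGen A cv g → ¬ ¬ Σcoeff (_≡ᵇ w) (h *P g) ≈ 0#
      multiples≈0 [] _ _ ¬0≈0 = ¬0≈0 ≈-refl
      multiples≈0 ((α , a) ∷ h) g g-init =
        ¬¬-zipWith (λ x y → ≈-trans (Σcoeff-++ (_≡ᵇ w) (L.map (scale α a) g) (h *P g)) (≈-trans (+-cong x y) (+-identityʳ 0#)))
          (¬¬-map (λ z → ≈-trans (Σcoeff-scale (_≡ᵇ w) α a g) (≈-trans (*-cong ≈-refl z) (zeroʳ α))) cofactors≈0)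
          (multiples≈0 h g g-init)
        where
        cofactors≈0 : ¬ ¬ Σcoeff (λ u → (a +ᵐ u) ≡ᵇ w) g ≈ 0#
        cofactors≈0 = ¬¬-Σcoeff≈0# _ g λ u a+u≡w → initialForm-vanishes-at-optimum {g} g-init
          (cofactor-optimal a u (T-does ((a +ᵐ u) ≟ᵐ w) a+u≡w))

    1∉initialIdeal : (∀ v → apply A v ≡ apply A 0ᵐ → v ≡ 0ᵐ) → ¬ InInitialIdeal A cv 0ᵐ
    1∉initialIdeal pointed = ∉-initialIdeal 0ᵐ cofactor-optimal
      where
      0ᵐ-optimal : Optimal A cv 0ᵐ
      0ᵐ-optimal v Av≡A0 v≢0 = ⊥-elim (v≢0 (pointed v Av≡A0))

      cofactor-optimal : ∀ a u → a +ᵐ u ≡ 0ᵐ → Optimal A cv u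
      cofactor-optimal a u a+u≡0 rewrite +ᵐ≡0ᵐ⇒≡0ᵐ a u a+u≡0 = 0ᵐ-optimal

    binom-initialForm : ∀ u v → cost cv v ℚ.< cost cv u → IsInitialForm cv (binom u v) (mono u)
    binom-initialForm u v v<u = cost cv u , ≤cost-u , (u , leading≉0 , refl) , agree , vanish
      where
      binom-coeff : Bool → Bool → Carrier
      binom-coeff b b′ = if b then 1# + (if b′ then - 1# + 0# else 0#) else (if b′ then - 1# + 0# else 0#)

      u≢v : u ≢ v
      u≢v u≡v = ℚP.<-irrefl (cong (cost cv) (sym u≡v)) v<u

      binom-u : coeff (binom u v) u ≈ 1#
      binom-u = ≈-trans (reflexive (cong₂ binom-coeff (dec-true (u ≟ᵐ u) refl) (dec-false (v ≟ᵐ u) (u≢v ∘ sym)))) (+-identityʳ 1#)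

      binom-other : ∀ {e} → e ≢ u → e ≢ v → coeff (binom u v) e ≈ 0#
      binom-other {e} e≢u e≢v = reflexive (cong₂ binom-coeff (dec-false (u ≟ᵐ e) (e≢u ∘ sym)) (dec-false (v ≟ᵐ e) (e≢v ∘ sym)))

      leading≉0 : ¬ coeff (binom u v) u ≈ 0#
      leading≉0 u≈0 = 0≉1 (≈-trans (≈-sym u≈0) binom-u)

      ≤cost-u : ∀ e → ¬ coeff (binom u v) e ≈ 0# → cost cv e ℚ.≤ cost cv u
      ≤cost-u e e∈supp = by-cases (e ≟ᵐ u) (e ≟ᵐ v)
        where
        by-cases : Dec (e ≡ u) → Dec (e ≡ v) → cost cv e ℚ.≤ cost cv u
        by-cases (yes e≡u) _ = ℚP.≤-reflexive (cong (cost cv) e≡u)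
        by-cases (no _) (yes e≡v) = subst (λ x → cost cv x ℚ.≤ cost cv u) (sym e≡v) (ℚP.<⇒≤ v<u)
        by-cases (no e≢u) (no e≢v) = ⊥-elim (e∈supp (binom-other e≢u e≢v))

      agree : ∀ e → cost cv e ≡ cost cv u → coeff (mono u) e ≈ coeff (binom u v) e
      agree e same-cost = by-cases (e ≟ᵐ u) (e ≟ᵐ v)
        where
        by-cases : Dec (e ≡ u) → Dec (e ≡ v) → coeff (mono u) e ≈ coeff (binom u v) e
        by-cases (yes e≡u) _ = subst (λ x → coeff (mono u) x ≈ coeff (binom u v) x) (sym e≡u) (≈-trans (mono-self u) (≈-sym binom-u))
        by-cases (no _) (yes e≡v) = ⊥-elim (ℚP.<-irrefl (trans (cong (cost cv) (sym e≡v)) same-cost) v<u)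
        by-cases (no e≢u) (no e≢v) = ≈-trans (mono-other e≢u) (≈-sym (binom-other e≢u e≢v))

      vanish : ∀ e → cost cv e ≢ cost cv u → coeff (mono u) e ≈ 0#
      vanish e cost≢ = by-cases (e ≟ᵐ u)
        where
        by-cases : Dec (e ≡ u) → coeff (mono u) e ≈ 0#
        by-cases (yes e≡u) = ⊥-elim (cost≢ (cong (cost cv) e≡u))
        by-cases (no e≢u) = mono-other e≢u

    ∈-initialIdeal : ∀ u v → apply A u ≡ apply A v → cost cv v ℚ.< cost cv u → ∀ w → u ∣ᵐ w → InInitialIdeal A cv w
    ∈-initialIdeal u v Au≡Av v<u w u∣w =
      let (gs , w≈gs) = generator-multiple-∈ {S = InitGen A cv} {mono u} (mono (w ∸ᵐ u)) (binom u v , binom∈I , binom-initialForm u v v<u)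
      in gs , λ e → ≈-trans (reflexive (cong (λ x → coeff (mono x) e) (sym (∸ᵐ-+ᵐ {u = u} {w} u∣w))))
                      (≈-trans (≈-sym (mono-*P-mono (w ∸ᵐ u) u e)) (w≈gs e))
      where
      binom∈I : InToric A (binom u v)
      binom∈I = let (gs , eq) = generator-multiple-∈ {S = ToricGen A} {binom u v} (mono 0ᵐ) (u , v , Au≡Av , refl)
                in gs , λ e → ≈-trans (≈-sym (*P-identityˡ (binom u v) e)) (eq e)

-- Standard pairs

⊆∧≢⇒⊂ : ∀ {n} {p q : Subset n} → p ⊆ q → p ≢ q → p ⊂ q
⊆∧≢⇒⊂ {p = p} {q} p⊆q p≢q with p SP.⊂? q
... | yes p⊂q = p⊂q
... | no p⊄q = ⊥-elim (p≢q (SP.⊆-antisym p⊆q λ {x} x∈q →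
  decidable-stable (x SP.∈? p) λ x∉p → p⊄q (p⊆q , x , x∈q , x∉p)))

unit-suppIn : ∀ {n} {σ : Subset n} {i} → i S.∈ σ → SuppIn (unit i) σ
unit-suppIn {σ = σ} i∈σ j nz = subst (S._∈ σ) (sym (unit-support _ j nz)) i∈σ

suppIn-⊥ : ∀ {n} (w : Mon n) → SuppIn w S.⊥ → w ≡ 0ᵐ
suppIn-⊥ w w⊆⊥ = lookup-ext λ i → trans (decidable-stable (lookup w i ℕ.≟ 0) (SP.∉⊥ ∘ w⊆⊥ i)) (sym (lookup-0ᵐ i))

dominating-0ᵐ : ∀ {n} {σ σ′ : Subset n} {a′ : Mon n} → (a′ , σ′) ≢ (0ᵐ , σ) → a′ ∣ᵐ 0ᵐ → σ ⊆ σ′ → a′ ≡ 0ᵐ × σ ⊂ σ′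
dominating-0ᵐ {a′ = a′} distinct a′∣0 σ⊆σ′ with ∣ᵐ0ᵐ⇒≡0ᵐ a′ a′∣0
... | refl = refl , ⊆∧≢⇒⊂ σ⊆σ′ (distinct ∘ cong (0ᵐ ,_) ∘ sym)

module _ {n : ℕ} {s : Level} (J : Mon n → Set s) where

  arithDeg-variableIdeal : (σ : Subset n) → (∀ w e → lookup w e ≢ 0 → e S.∉ σ → J w) →
    (∀ w → SuppIn w σ → ¬ J w) → ArithDeg J 1
  arithDeg-variableIdeal σ J∋ J∌ = ((0ᵐ , σ) ∷ []) , ([] ∷ []) , refl , λ p → mk⇔ (∈-standardPairs p) ∈⇒standard
    where
    admissible : Admissible J (0ᵐ , σ)
    admissible = (λ i nz _ → nz (lookup-0ᵐ i)) , λ w w⊆σ → J∌ (0ᵐ +ᵐ w) (subst (λ x → SuppIn x σ) (sym (+ᵐ-identityˡ w)) w⊆σ)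

    standard : StandardPair J (0ᵐ , σ)
    standard = admissible , λ { (a′ , σ′ , (_ , adm′) , distinct , a′∣0 , _ , _ , _ , σ⊆σ′) →
      case dominating-0ᵐ distinct a′∣0 σ⊆σ′ of λ { (refl , (_ , i , i∈σ′ , i∉σ)) →
        adm′ (unit i) (unit-suppIn i∈σ′) (J∋ (0ᵐ +ᵐ unit i) i (+ᵐ-unit-support 0ᵐ i) i∉σ) } }

    ∈-standardPairs : ∀ p → StandardPair J p → p ∈ ((0ᵐ , σ) ∷ [])
    ∈-standardPairs (a , τ) ((_ , adm) , minimal) with PP.≡-dec (VP.≡-dec ℕ._≟_) (VP.≡-dec Bool._≟_) (a , τ) (0ᵐ , σ)
    ... | yes eq = here eq
    ... | no distinct = ⊥-elim (minimal (0ᵐ , σ , admissible , distinct ∘ sym , 0ᵐ∣ᵐ a , a , +ᵐ-identityˡ a , a⊆σ , τ⊆σ))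
      where
      a⊆σ : ∀ i → lookup a i ≢ 0 → i S.∈ σ
      a⊆σ i nz = decidable-stable (i SP.∈? σ) λ i∉σ →
        adm 0ᵐ (λ j nz → ⊥-elim (nz (lookup-0ᵐ j))) (J∋ (a +ᵐ 0ᵐ) i (subst (λ x → lookup x i ≢ 0) (sym (+ᵐ-identityʳ a)) nz) i∉σ)
      τ⊆σ : τ ⊆ σ
      τ⊆σ {i} i∈τ = decidable-stable (i SP.∈? σ) λ i∉σ →
        adm (unit i) (unit-suppIn i∈τ) (J∋ (a +ᵐ unit i) i (+ᵐ-unit-support a i) i∉σ)

    ∈⇒standard : ∀ {p} → p ∈ ((0ᵐ , σ) ∷ []) → StandardPair J p
    ∈⇒standard (here refl) = standard

  no-standardPair⇒¬admissible : (∀ p → ¬ StandardPair J p) → ∀ σ → ¬ Admissible J (0ᵐ , σ)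
  no-standardPair⇒¬admissible none σ = go σ (⊃-wellFounded σ)
    where
    go : ∀ σ → Acc S._⊃_ σ → ¬ Admissible J (0ᵐ , σ)
    go σ (acc larger) adm = none (0ᵐ , σ) (adm , λ { (a′ , σ′ , adm′ , distinct , a′∣0 , _ , _ , _ , σ⊆σ′) →
      case dominating-0ᵐ distinct a′∣0 σ⊆σ′ of λ { (refl , σ⊂σ′) → go σ′ (larger σ⊂σ′) adm′ } })

  arithDeg-positive : ¬ J 0ᵐ → ∀ m → ArithDeg J m → 1 ≤ m
  arithDeg-positive _ m (_ ∷ _ , _ , refl , _) = ℕ.s≤s ℕ.z≤n
  arithDeg-positive J∌1 m ([] , _ , _ , standard⇔∈) =
    ⊥-elim (no-standardPair⇒¬admissible (λ p sp → case Equivalence.to (standard⇔∈ p) sp of λ ()) S.⊥ admissible-⊥)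
    where
    admissible-⊥ : Admissible J (0ᵐ , S.⊥)
    admissible-⊥ = (λ i nz _ → nz (lookup-0ᵐ i)) , λ w w⊆⊥ → J∌1 ∘ subst J (trans (+ᵐ-identityˡ w) (suppIn-⊥ w w⊆⊥))

-- The acyclic tournament

lookup-injective : ∀ {a} {X : Set a} {xs : List X} → Unique xs → ∀ i j → L.lookup xs i ≡ L.lookup xs j → i ≡ j
lookup-injective {xs = x ∷ xs} _ zero zero _ = refl
lookup-injective {xs = x ∷ xs} (x∉xs ∷ _) zero (suc j) eq = ⊥-elim (All¬⇒¬Any x∉xs (subst (_∈ xs) (sym eq) (∈-lookup j)))
lookup-injective {xs = x ∷ xs} (x∉xs ∷ _) (suc i) zero eq = ⊥-elim (All¬⇒¬Any x∉xs (subst (_∈ xs) eq (∈-lookup i)))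
lookup-injective {xs = x ∷ xs} (_ ∷ uniq) (suc i) (suc j) eq = cong suc (lookup-injective uniq i j eq)

module Tournament (d : ℕ) where

  n : ℕ
  n = numArcs d

  A : Matrix d n
  A = incidence d

  tl hd : Fin n → ℕ
  tl e = toℕ (proj₁ (arc d e))
  hd e = toℕ (proj₂ (arc d e))

  private
    forward? : (a : Fin d × Fin d) → Dec (toℕ (proj₁ a) ℕ.< toℕ (proj₂ a))
    forward? a = toℕ (proj₁ a) ℕ.<? toℕ (proj₂ a)

    row-arcs : ∀ i ys → L.concatMap (λ j → if does (toℕ i ℕ.<? toℕ j) then (i , j) ∷ [] else []) ys
                        ≡ L.filter forward? (L.map (i ,_) ys)
    row-arcs i [] = refl
    row-arcs i (y ∷ ys) with does (toℕ i ℕ.<? toℕ y)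
    ... | true = cong ((i , y) ∷_) (row-arcs i ys)
    ... | false = row-arcs i ys

    all-arcs : ∀ xs ys →
      L.concatMap (λ i → L.concatMap (λ j → if does (toℕ i ℕ.<? toℕ j) then (i , j) ∷ [] else []) ys) xs
        ≡ L.filter forward? (L.cartesianProduct xs ys)
    all-arcs [] ys = refl
    all-arcs (x ∷ xs) ys = trans (cong₂ L._++_ (row-arcs x ys) (all-arcs xs ys))
      (sym (LP.filter-++ forward? (L.map (x ,_) ys) (L.cartesianProduct xs ys)))

  arcs≡filter : arcs d ≡ L.filter forward? (L.cartesianProduct (L.allFin d) (L.allFin d))
  arcs≡filter = all-arcs (L.allFin d) (L.allFin d)

  tl<hd : ∀ e → tl e ℕ.< hd e
  tl<hd e = proj₂ (∈-filter⁻ forward? {xs = L.cartesianProduct (L.allFin d) (L.allFin d)}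
    (subst (arc d e ∈_) arcs≡filter (∈-lookup e)))

  hd<d : ∀ e → hd e ℕ.< d
  hd<d e = FinP.toℕ<n (proj₂ (arc d e))

  arc-injective : ∀ e e′ → arc d e ≡ arc d e′ → e ≡ e′
  arc-injective = lookup-injective (subst Unique (sym arcs≡filter)
    (Uniq.filter⁺ forward? (Uniq.cartesianProduct⁺ (Uniq.allFin⁺ d) (Uniq.allFin⁺ d))))

  arc-surjective : ∀ (i j : Fin d) → toℕ i ℕ.< toℕ j → ∃ λ e → arc d e ≡ (i , j)
  arc-surjective i j i<j = let i,j∈arcs = subst ((i , j) ∈_) (sym arcs≡filter)
                                 (∈-filter⁺ forward? (∈-cartesianProduct⁺ (∈-allFin i) (∈-allFin j)) i<j)
                           in Any.index i,j∈arcs , sym (AnyP.lookup-index i,j∈arcs)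

  δ : ℕ → ℕ → ℕ
  δ a b = if does (a ℕ.≟ b) then 1 else 0

  δ-≡ : ∀ a → δ a a ≡ 1
  δ-≡ a = cong (if_then 1 else 0) (dec-true (a ℕ.≟ a) refl)

  δ-≢ : ∀ {a b} → a ≢ b → δ a b ≡ 0
  δ-≢ {a} {b} a≢b = cong (if_then 1 else 0) (dec-false (a ℕ.≟ b) a≢b)

  δ-suc : ∀ a b → δ (ℕ.suc a) (ℕ.suc b) ≡ δ a b
  δ-suc a b with a ℕ.≟ b
  ... | yes refl = trans (δ-≡ (ℕ.suc a)) (sym (δ-≡ a))
  ... | no a≢b = trans (δ-≢ (a≢b ∘ ℕP.suc-injective)) (sym (δ-≢ a≢b))

  ι : Fin d → ℕ → ℤ.ℤ
  ι r x = ℤ.+ δ (toℕ r) x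

  column : ∀ r e → A r e ≡ ι r (tl e) ℤ.- ι r (hd e)
  column r e = column-of (proj₁ (arc d e)) (proj₂ (arc d e)) (tl<hd e)
    where
    column-of : ∀ i j → toℕ i ℕ.< toℕ j →
      (if does (r Fin.≟ i) then ℤ.+ 1 else if does (r Fin.≟ j) then ℤ.- ℤ.+ 1 else ℤ.+ 0) ≡ ι r (toℕ i) ℤ.- ι r (toℕ j)
    column-of i j i<j with r Fin.≟ i | r Fin.≟ j
    ... | yes refl | _ rewrite δ-≡ (toℕ r) | δ-≢ (ℕP.<⇒≢ i<j) = refl
    ... | no r≢i | yes refl rewrite δ-≢ (r≢i ∘ FinP.toℕ-injective) | δ-≡ (toℕ r) = refl
    ... | no r≢i | no r≢j rewrite δ-≢ (r≢i ∘ FinP.toℕ-injective) | δ-≢ (r≢j ∘ FinP.toℕ-injective) = refl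

  tl,hd-injective : ∀ {e e′} → tl e ≡ tl e′ → hd e ≡ hd e′ → e ≡ e′
  tl,hd-injective {e} {e′} tl≡ hd≡ = arc-injective e e′ (cong₂ _,_ (FinP.toℕ-injective tl≡) (FinP.toℕ-injective hd≡))

  IsPath : Fin n → Set
  IsPath e = hd e ≡ ℕ.suc (tl e)

  isPath? : ∀ e → Dec (IsPath e)
  isPath? e = hd e ℕ.≟ ℕ.suc (tl e)

  private
    pathArc-spec : ∀ j (lt : ℕ.suc j ℕ.< d) → ∃ λ e → arc d e ≡ (Fin.fromℕ< (ℕP.<-trans (ℕP.n<1+n j) lt) , Fin.fromℕ< lt)
    pathArc-spec j lt = arc-surjective _ _
      (subst₂ ℕ._<_ (sym (FinP.toℕ-fromℕ< _)) (sym (FinP.toℕ-fromℕ< lt)) (ℕP.n<1+n j))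

  pathArc : ∀ j → ℕ.suc j ℕ.< d → Fin n
  pathArc j lt = proj₁ (pathArc-spec j lt)

  pathArc-tl : ∀ j lt → tl (pathArc j lt) ≡ j
  pathArc-tl j lt = trans (cong (toℕ ∘ proj₁) (proj₂ (pathArc-spec j lt))) (FinP.toℕ-fromℕ< _)

  pathArc-hd : ∀ j lt → hd (pathArc j lt) ≡ ℕ.suc j
  pathArc-hd j lt = trans (cong (toℕ ∘ proj₂) (proj₂ (pathArc-spec j lt))) (FinP.toℕ-fromℕ< lt)

  pathArc-isPath : ∀ j lt → IsPath (pathArc j lt)
  pathArc-isPath j lt = trans (pathArc-hd j lt) (cong ℕ.suc (sym (pathArc-tl j lt)))

  pathArc-irrelevant : ∀ j lt lt′ → pathArc j lt ≡ pathArc j lt′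
  pathArc-irrelevant j lt lt′ = cong (pathArc j) (ℕP.<-irrelevant lt lt′)

  pathArc-tl≡ : ∀ e → IsPath e → (lt : ℕ.suc (tl e) ℕ.< d) → pathArc (tl e) lt ≡ e
  pathArc-tl≡ e e-path lt = tl,hd-injective (pathArc-tl (tl e) lt) (trans (pathArc-hd (tl e) lt) (sym e-path))

  row-pathArc : ∀ s lt r → row A (unit (pathArc s lt)) r ≡ ι r s ℤ.- ι r (ℕ.suc s)
  row-pathArc s lt r = trans (row-unit A (pathArc s lt) r)
    (trans (column r (pathArc s lt)) (cong₂ (λ x y → ι r x ℤ.- ι r y) (pathArc-tl s lt) (pathArc-hd s lt)))

  private
    first-bound : ∀ s g → s ℕ.+ ℕ.suc g ℕ.< d → ℕ.suc s ℕ.< d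
    first-bound s g = ℕP.≤-<-trans (subst (ℕ.suc s ℕ.≤_) (sym (ℕP.+-suc s g)) (ℕ.s≤s (ℕP.m≤m+n s g)))

    rest-bound : ∀ s g → s ℕ.+ ℕ.suc (ℕ.suc g) ℕ.< d → ℕ.suc s ℕ.+ ℕ.suc g ℕ.< d
    rest-bound s g = subst (ℕ._< d) (ℕP.+-suc s (ℕ.suc g))

  -- the g + 1 arcs of the path s → s + 1 → ⋯ → s + g + 1
  path : ∀ s g → s ℕ.+ ℕ.suc g ℕ.< d → Mon n
  path s ℕ.zero lt = unit (pathArc s (first-bound s 0 lt))
  path s (ℕ.suc g) lt = unit (pathArc s (first-bound s (ℕ.suc g) lt)) +ᵐ path (ℕ.suc s) g (rest-bound s g lt)

  row-path : ∀ s g lt r → row A (path s g lt) r ≡ ι r s ℤ.- ι r (s ℕ.+ ℕ.suc g)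
  row-path s ℕ.zero lt r = trans (row-pathArc s (first-bound s 0 lt) r) (cong (λ y → ι r s ℤ.- ι r y) (ℕP.+-comm 1 s))
  row-path s (ℕ.suc g) lt r = begin
    row A (unit (pathArc s first) +ᵐ path (ℕ.suc s) g rest) r
      ≡⟨ row-+ᵐ A (unit (pathArc s first)) (path (ℕ.suc s) g rest) r ⟩
    row A (unit (pathArc s first)) r ℤ.+ row A (path (ℕ.suc s) g rest) r
      ≡⟨ cong₂ ℤ._+_ (row-pathArc s first r) (row-path (ℕ.suc s) g rest r) ⟩
    (ι r s ℤ.- ι r (ℕ.suc s)) ℤ.+ (ι r (ℕ.suc s) ℤ.- ι r (ℕ.suc s ℕ.+ ℕ.suc g))
      ≡⟨ ℤP.+-minus-telescope (ι r s) (ι r (ℕ.suc s)) (ι r (ℕ.suc s ℕ.+ ℕ.suc g)) ⟩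
    ι r s ℤ.- ι r (ℕ.suc s ℕ.+ ℕ.suc g)
      ≡⟨ cong (λ y → ι r s ℤ.- ι r y) (ℕP.+-suc s (ℕ.suc g)) ⟨
    ι r s ℤ.- ι r (s ℕ.+ ℕ.suc (ℕ.suc g))
      ∎
    where
    open ≡-Reasoning
    first : ℕ.suc s ℕ.< d
    first = first-bound s (ℕ.suc g) lt
    rest : ℕ.suc s ℕ.+ ℕ.suc g ℕ.< d
    rest = rest-bound s g lt

  path-nonzero : ∀ s g lt → path s g lt ≢ 0ᵐ
  path-nonzero s ℕ.zero lt = unit-nonzero _
  path-nonzero s (ℕ.suc g) lt eq = unit-nonzero _ (+ᵐ≡0ᵐ⇒≡0ᵐ _ _ (trans (+ᵐ-comm _ _) eq))

  private
    detour-end : ∀ e → tl e ℕ.+ ℕ.suc (hd e ℕ.∸ ℕ.suc (tl e)) ≡ hd e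
    detour-end e = trans (ℕP.+-suc (tl e) _) (ℕP.m+[n∸m]≡n (tl<hd e))

    detour-bound : ∀ e → tl e ℕ.+ ℕ.suc (hd e ℕ.∸ ℕ.suc (tl e)) ℕ.< d
    detour-bound e = subst (ℕ._< d) (sym (detour-end e)) (hd<d e)

  detour : Fin n → Mon n
  detour e = path (tl e) (hd e ℕ.∸ ℕ.suc (tl e)) (detour-bound e)

  detour-nonzero : ∀ e → detour e ≢ 0ᵐ
  detour-nonzero e = path-nonzero (tl e) _ (detour-bound e)

  apply-detour : ∀ e → apply A (detour e) ≡ apply A (unit e)
  apply-detour e = row≡⇒apply≡ A {detour e} {unit e} λ r → begin
    row A (detour e) r                                            ≡⟨ row-path (tl e) _ _ r ⟩
    ι r (tl e) ℤ.- ι r (tl e ℕ.+ ℕ.suc (hd e ℕ.∸ ℕ.suc (tl e)))   ≡⟨ cong (λ y → ι r (tl e) ℤ.- ι r y) (detour-end e) ⟩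
    ι r (tl e) ℤ.- ι r (hd e)                                     ≡⟨ column r e ⟨
    A r e                                                         ≡⟨ row-unit A e r ⟨
    row A (unit e) r                                              ∎
    where open ≡-Reasoning

  PathOnly : Mon n → Set
  PathOnly u = ∀ e → lookup u e ≢ 0 → IsPath e

  pathOnly-0ᵐ : PathOnly 0ᵐ
  pathOnly-0ᵐ e nz = ⊥-elim (nz (lookup-0ᵐ e))

  pathOnly-+ᵐ : ∀ {u v} → PathOnly u → PathOnly v → PathOnly (u +ᵐ v)
  pathOnly-+ᵐ {u} {v} u-path v-path e nz with +ᵐ-support u v e nz
  ... | inj₁ uₑ≢0 = u-path e uₑ≢0
  ... | inj₂ vₑ≢0 = v-path e vₑ≢0

  pathOnly-+ᵐ⁻ʳ : ∀ a {u} → PathOnly (a +ᵐ u) → PathOnly u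
  pathOnly-+ᵐ⁻ʳ a {u} a+u-path e nz = a+u-path e (+ᵐ-supportʳ a u e nz)

  pathOnly-unit : ∀ {e} → IsPath e → PathOnly (unit e)
  pathOnly-unit e-path i nz = subst IsPath (sym (unit-support _ i nz)) e-path

  pathOnly-path : ∀ s g lt → PathOnly (path s g lt)
  pathOnly-path s ℕ.zero lt = pathOnly-unit (pathArc-isPath s (first-bound s 0 lt))
  pathOnly-path s (ℕ.suc g) lt = pathOnly-+ᵐ {unit (pathArc s first)} {path (ℕ.suc s) g rest}
    (pathOnly-unit (pathArc-isPath s first)) (pathOnly-path (ℕ.suc s) g rest)
    where
    first : ℕ.suc s ℕ.< d
    first = first-bound s (ℕ.suc g) lt
    rest : ℕ.suc s ℕ.+ ℕ.suc g ℕ.< d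
    rest = rest-bound s g lt

  pathOnly-detour : ∀ e → PathOnly (detour e)
  pathOnly-detour e = pathOnly-path (tl e) _ (detour-bound e)

  -- replace every arc by its detour along consecutive vertices
  pathProjection : ∀ u → ∃ λ p → PathOnly p × apply A p ≡ apply A u × (p ≡ 0ᵐ → u ≡ 0ᵐ)
  pathProjection u = mon-induction (λ _ → ⊤) Projection (0ᵐ , pathOnly-0ᵐ , refl , λ _ → refl) step u (λ _ _ → tt)
    where
    Projection : Mon n → Set
    Projection u = ∃ λ p → PathOnly p × apply A p ≡ apply A u × (p ≡ 0ᵐ → u ≡ 0ᵐ)

    step : ∀ u i → ⊤ → Projection u → Projection (u +ᵐ unit i)
    step u i _ (p , p-path , Ap≡Au , _) =
      p +ᵐ detour i , pathOnly-+ᵐ {p} {detour i} p-path (pathOnly-detour i) ,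
      apply-+ᵐ-cong A {p} {detour i} {u} {unit i} Ap≡Au (apply-detour i) ,
      λ eq → ⊥-elim (detour-nonzero i (+ᵐ≡0ᵐ⇒≡0ᵐ p (detour i) eq))

  -- the flow of a path-only monomial across the cut between vertices j and j + 1 (0 if j + 1 ≥ d)
  cut : Mon n → ℕ → ℕ
  cut p j with ℕ.suc j ℕ.<? d
  ... | yes lt = lookup p (pathArc j lt)
  ... | no _ = 0

  cut-< : ∀ p j lt → cut p j ≡ lookup p (pathArc j lt)
  cut-< p j lt with ℕ.suc j ℕ.<? d
  ... | yes lt′ = cong (lookup p) (pathArc-irrelevant j lt′ lt)
  ... | no ≮ = ⊥-elim (≮ lt)

  cut-≮ : ∀ p j → ¬ ℕ.suc j ℕ.< d → cut p j ≡ 0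
  cut-≮ p j ≮ with ℕ.suc j ℕ.<? d
  ... | yes lt = ⊥-elim (≮ lt)
  ... | no _ = refl

  cutBefore : Mon n → ℕ → ℕ
  cutBefore p ℕ.zero = 0
  cutBefore p (ℕ.suc j) = cut p j

  cut-0ᵐ : ∀ j → cut 0ᵐ j ≡ 0
  cut-0ᵐ j with ℕ.suc j ℕ.<? d
  ... | yes lt = lookup-0ᵐ (pathArc j lt)
  ... | no _ = refl

  cutBefore-0ᵐ : ∀ j → cutBefore 0ᵐ j ≡ 0
  cutBefore-0ᵐ ℕ.zero = refl
  cutBefore-0ᵐ (ℕ.suc j) = cut-0ᵐ j

  lookup-unit-pathArc : ∀ {e} → IsPath e → ∀ j lt → lookup (unit e) (pathArc j lt) ≡ δ j (tl e)
  lookup-unit-pathArc {e} e-path j lt with j ℕ.≟ tl e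
  ... | yes refl = trans (cong (lookup (unit e)) (pathArc-tl≡ e e-path lt)) (trans (lookup-unit-≡ e) (sym (δ-≡ j)))
  ... | no j≢tl = trans (lookup-unit-≢ (j≢tl ∘ trans (sym (pathArc-tl j lt)) ∘ cong tl)) (sym (δ-≢ j≢tl))

  cut-+ᵐ-unit : ∀ u {e} → IsPath e → ∀ j → cut (u +ᵐ unit e) j ≡ cut u j ℕ.+ δ j (tl e)
  cut-+ᵐ-unit u {e} e-path j with ℕ.suc j ℕ.<? d
  ... | yes lt = trans (lookup-+ᵐ u (unit e) (pathArc j lt)) (cong (lookup u (pathArc j lt) ℕ.+_) (lookup-unit-pathArc e-path j lt))
  ... | no ≮ = sym (δ-≢ {j} {tl e} λ { refl → ≮ (subst (ℕ._< d) e-path (hd<d e)) })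

  cutBefore-+ᵐ-unit : ∀ u {e} → IsPath e → ∀ j → cutBefore (u +ᵐ unit e) j ≡ cutBefore u j ℕ.+ δ j (hd e)
  cutBefore-+ᵐ-unit u {e} e-path ℕ.zero = sym (δ-≢ λ 0≡hd → ℕP.1+n≢0 (sym (trans 0≡hd e-path)))
  cutBefore-+ᵐ-unit u {e} e-path (ℕ.suc j) = trans (cut-+ᵐ-unit u e-path j)
    (cong (cut u j ℕ.+_) (trans (sym (δ-suc j (tl e))) (cong (δ (ℕ.suc j)) (sym e-path))))

  row-pathOnly : ∀ p → PathOnly p → ∀ r → row A p r ℤ.+ ℤ.+ cutBefore p (toℕ r) ≡ ℤ.+ cut p (toℕ r)
  row-pathOnly = mon-induction IsPath RowFormula base step
    where
    RowFormula : Mon n → Set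
    RowFormula p = ∀ r → row A p r ℤ.+ ℤ.+ cutBefore p (toℕ r) ≡ ℤ.+ cut p (toℕ r)

    base : RowFormula 0ᵐ
    base r = trans (cong₂ ℤ._+_ (row-0ᵐ A r) (cong ℤ.+_ (cutBefore-0ᵐ (toℕ r)))) (cong ℤ.+_ (sym (cut-0ᵐ (toℕ r))))

    rearrange : ∀ R X Y C → (R ℤ.+ (X ℤ.- Y)) ℤ.+ (C ℤ.+ Y) ≡ (R ℤ.+ C) ℤ.+ X
    rearrange = solve-∀

    step : ∀ u e → IsPath e → RowFormula u → RowFormula (u +ᵐ unit e)
    step u e e-path formula r = begin
      row A (u +ᵐ unit e) r ℤ.+ ℤ.+ cutBefore (u +ᵐ unit e) j
        ≡⟨ cong₂ ℤ._+_ (trans (row-+ᵐ A u (unit e) r) (cong (λ z → row A u r ℤ.+ z) (trans (row-unit A e r) (column r e))))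
                       (trans (cong ℤ.+_ (cutBefore-+ᵐ-unit u e-path j)) (ℤP.pos-+ (cutBefore u j) (δ j (hd e)))) ⟩
      (row A u r ℤ.+ (ι r (tl e) ℤ.- ι r (hd e))) ℤ.+ (ℤ.+ cutBefore u j ℤ.+ ι r (hd e))
        ≡⟨ rearrange (row A u r) (ι r (tl e)) (ι r (hd e)) (ℤ.+ cutBefore u j) ⟩
      (row A u r ℤ.+ ℤ.+ cutBefore u j) ℤ.+ ι r (tl e)
        ≡⟨ cong (λ z → z ℤ.+ ι r (tl e)) (formula r) ⟩
      ℤ.+ cut u j ℤ.+ ι r (tl e)
        ≡⟨ trans (cong ℤ.+_ (cut-+ᵐ-unit u e-path j)) (ℤP.pos-+ (cut u j) (δ j (tl e))) ⟨
      ℤ.+ cut (u +ᵐ unit e) j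
        ∎
      where
      open ≡-Reasoning
      j : ℕ
      j = toℕ r

  pathOnly-vanishes : ∀ p → PathOnly p → ∀ e → ¬ IsPath e → lookup p e ≡ 0
  pathOnly-vanishes p p-path e ¬path = decidable-stable (lookup p e ℕ.≟ 0) (¬path ∘ p-path e)

  apply-injective-pathOnly : ∀ {p q} → PathOnly p → PathOnly q → apply A p ≡ apply A q → p ≡ q
  apply-injective-pathOnly {p} {q} p-path q-path Ap≡Aq = lookup-ext lookup≡
    where
    cut≡-at : ∀ r → cutBefore p (toℕ r) ≡ cutBefore q (toℕ r) → cut p (toℕ r) ≡ cut q (toℕ r)
    cut≡-at r before≡ = ℤP.+-injective (begin
      ℤ.+ cut p (toℕ r)                         ≡⟨ row-pathOnly p p-path r ⟨
      row A p r ℤ.+ ℤ.+ cutBefore p (toℕ r)     ≡⟨ cong₂ (λ x y → x ℤ.+ ℤ.+ y) (apply≡⇒row≡ A {p} {q} Ap≡Aq r) before≡ ⟩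
      row A q r ℤ.+ ℤ.+ cutBefore q (toℕ r)     ≡⟨ row-pathOnly q q-path r ⟩
      ℤ.+ cut q (toℕ r)                         ∎)
      where open ≡-Reasoning

    cut≡ : ∀ j → cutBefore p j ≡ cutBefore q j → cut p j ≡ cut q j
    cut≡ j with j ℕ.<? d
    ... | yes j<d = subst (λ i → cutBefore p i ≡ cutBefore q i → cut p i ≡ cut q i)
                      (FinP.toℕ-fromℕ< j<d) (cut≡-at (Fin.fromℕ< j<d))
    ... | no j≮d = λ _ → trans (cut-≮ p j ≮) (sym (cut-≮ q j ≮))
      where
      ≮ : ¬ ℕ.suc j ℕ.< d
      ≮ = j≮d ∘ ℕP.<⇒≤

    cuts≡ : ∀ j → cut p j ≡ cut q j
    cuts≡ ℕ.zero = cut≡ 0 refl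
    cuts≡ (ℕ.suc j) = cut≡ (ℕ.suc j) (cuts≡ j)

    lookup≡ : ∀ e → lookup p e ≡ lookup q e
    lookup≡ e with isPath? e
    ... | no ¬path = trans (pathOnly-vanishes p p-path e ¬path) (sym (pathOnly-vanishes q q-path e ¬path))
    ... | yes e-path = begin
      lookup p e                       ≡⟨ cong (lookup p) (pathArc-tl≡ e e-path lt) ⟨
      lookup p (pathArc (tl e) lt)     ≡⟨ cut-< p (tl e) lt ⟨
      cut p (tl e)                     ≡⟨ cuts≡ (tl e) ⟩
      cut q (tl e)                     ≡⟨ cut-< q (tl e) lt ⟩
      lookup q (pathArc (tl e) lt)     ≡⟨ cong (lookup q) (pathArc-tl≡ e e-path lt) ⟩
      lookup q e                       ∎
      where
      open ≡-Reasoning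
      lt : ℕ.suc (tl e) ℕ.< d
      lt = subst (ℕ._< d) e-path (hd<d e)

  pointed : ∀ v → apply A v ≡ apply A 0ᵐ → v ≡ 0ᵐ
  pointed v Av≡0 = let (p , p-path , Ap≡Av , p≡0⇒v≡0) = pathProjection v
                   in p≡0⇒v≡0 (apply-injective-pathOnly p-path pathOnly-0ᵐ (trans Ap≡Av Av≡0))

-- The cost vector that is free on the arcs (j , j + 1)

sumℚ-0 : ∀ {m} (t : Fin m → ℚ) → (∀ i → t i ≡ ℚ.0ℚ) → sumℚ (tabulate t) ≡ ℚ.0ℚ
sumℚ-0 {ℕ.zero} t t≡0 = refl
sumℚ-0 {ℕ.suc m} t t≡0 = cong₂ ℚ._+_ (t≡0 zero) (sumℚ-0 (t ∘ suc) (t≡0 ∘ suc))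

sumℚ-nonneg : ∀ {m} (t : Fin m → ℚ) → (∀ i → ℚ.0ℚ ℚ.≤ t i) → ℚ.0ℚ ℚ.≤ sumℚ (tabulate t)
sumℚ-nonneg {ℕ.zero} t t≥0 = ℚP.≤-refl
sumℚ-nonneg {ℕ.suc m} t t≥0 = ℚP.+-mono-≤ (t≥0 zero) (sumℚ-nonneg (t ∘ suc) (t≥0 ∘ suc))

sumℚ-pos : ∀ {m} (t : Fin m → ℚ) → (∀ i → ℚ.0ℚ ℚ.≤ t i) → ∀ e → ℚ.0ℚ ℚ.< t e → ℚ.0ℚ ℚ.< sumℚ (tabulate t)
sumℚ-pos t t≥0 zero tₑ>0 = ℚP.+-mono-<-≤ tₑ>0 (sumℚ-nonneg (t ∘ suc) (t≥0 ∘ suc))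
sumℚ-pos t t≥0 (suc e) tₑ>0 = ℚP.+-mono-≤-< (t≥0 zero) (sumℚ-pos (t ∘ suc) (t≥0 ∘ suc) e tₑ>0)

module PathCost (d : ℕ) where
  open Tournament d

  c-path : Vec ℚ n
  c-path = tabulate λ e → if does (isPath? e) then ℚ.0ℚ else ℚ.1ℚ

  private
    term : Mon n → Fin n → ℚ
    term u e = lookup c-path e ℚ.* (ℤ.+ lookup u e ℚ./ 1)

    lookup-c-path : ∀ e → lookup c-path e ≡ (if does (isPath? e) then ℚ.0ℚ else ℚ.1ℚ)
    lookup-c-path = VP.lookup∘tabulate _

    term-path : ∀ u {e} → IsPath e → term u e ≡ ℚ.0ℚ
    term-path u {e} e-path = trans (cong (ℚ._* (ℤ.+ lookup u e ℚ./ 1))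
      (trans (lookup-c-path e) (cong (if_then ℚ.0ℚ else ℚ.1ℚ) (dec-true (isPath? e) e-path)))) (ℚP.*-zeroˡ (ℤ.+ lookup u e ℚ./ 1))

    term-nonpath : ∀ u {e} → ¬ IsPath e → term u e ≡ ℤ.+ lookup u e ℚ./ 1
    term-nonpath u {e} ¬path = trans (cong (ℚ._* (ℤ.+ lookup u e ℚ./ 1))
      (trans (lookup-c-path e) (cong (if_then ℚ.0ℚ else ℚ.1ℚ) (dec-false (isPath? e) ¬path)))) (ℚP.*-identityˡ (ℤ.+ lookup u e ℚ./ 1))

    term-nonneg : ∀ u e → ℚ.0ℚ ℚ.≤ term u e
    term-nonneg u e = nonneg (isPath? e)
      where
      nonneg : Dec (IsPath e) → ℚ.0ℚ ℚ.≤ term u e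
      nonneg (yes e-path) = ℚP.≤-reflexive (sym (term-path u e-path))
      nonneg (no ¬path) = subst (ℚ.0ℚ ℚ.≤_) (sym (term-nonpath u ¬path)) (ℚP.nonNegative⁻¹ _ {{ℚP.normalize-nonNeg (lookup u e) 1}})

  cost-pathOnly : ∀ u → PathOnly u → cost c-path u ≡ ℚ.0ℚ
  cost-pathOnly u u-path = sumℚ-0 (term u) term≡0
    where
    term≡0 : ∀ e → term u e ≡ ℚ.0ℚ
    term≡0 e = vanishes (isPath? e)
      where
      vanishes : Dec (IsPath e) → term u e ≡ ℚ.0ℚ
      vanishes (yes e-path) = term-path u e-path
      vanishes (no ¬path) = trans (term-nonpath u ¬path) (cong (λ x → ℤ.+ x ℚ./ 1) (pathOnly-vanishes u u-path e ¬path))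

  cost-positive : ∀ u e → lookup u e ≢ 0 → ¬ IsPath e → ℚ.0ℚ ℚ.< cost c-path u
  cost-positive u e uₑ≢0 ¬path = sumℚ-pos (term u) (term-nonneg u) e
    (subst (ℚ.0ℚ ℚ.<_) (sym (term-nonpath u ¬path)) (positive (lookup u e) uₑ≢0))
    where
    positive : ∀ x → x ≢ 0 → ℚ.0ℚ ℚ.< ℤ.+ x ℚ./ 1
    positive ℕ.zero 0≢0 = ⊥-elim (0≢0 refl)
    positive x@(ℕ.suc _) _ = ℚP.positive⁻¹ _ {{ℚP.normalize-pos x 1}}

  pathOnly-optimal : ∀ b → PathOnly b → Optimal A c-path b
  pathOnly-optimal b b-path v Av≡Ab v≢b = optimal (FinP.any? λ e → ¬? (lookup v e ℕ.≟ 0) ×-dec ¬? (isPath? e))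
    where
    optimal : Dec (∃ λ e → lookup v e ≢ 0 × ¬ IsPath e) → cost c-path b ℚ.< cost c-path v
    optimal (yes (e , vₑ≢0 , ¬path)) = subst (ℚ._< cost c-path v) (sym (cost-pathOnly b b-path)) (cost-positive v e vₑ≢0 ¬path)
    optimal (no ∄) = ⊥-elim (v≢b (apply-injective-pathOnly v-path b-path Av≡Ab))
      where
      v-path : PathOnly v
      v-path e vₑ≢0 = decidable-stable (isPath? e) λ ¬path → ∄ (e , vₑ≢0 , ¬path)

  generic : Generic A c-path
  generic u = let (p , p-path , Ap≡Au , _) = pathProjection u
              in p , Ap≡Au , λ v Av≡Au → pathOnly-optimal p p-path v (trans Av≡Au (sym Ap≡Au))

  pathArcs : Subset n
  pathArcs = tabulate (does ∘ isPath?)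

  ∈-pathArcs⁻ : ∀ {e} → e S.∈ pathArcs → IsPath e
  ∈-pathArcs⁻ {e} e∈ = T-does (isPath? e) (subst T (trans (sym (VP.[]=⇒lookup e∈)) (VP.lookup∘tabulate _ e)) _)

  ∈-pathArcs⁺ : ∀ {e} → IsPath e → e S.∈ pathArcs
  ∈-pathArcs⁺ {e} e-path = VP.lookup⇒[]= e pathArcs (trans (VP.lookup∘tabulate _ e) (dec-true (isPath? e) e-path))


module InitialIdealOfPathCost {c ℓ : Level} (k : Field c ℓ) (d : ℕ) where
  open Tournament d
  open PathCost d
  open PolynomialFacts k n
  open InitialIdeal A c-path

  nonPath-∈-initialIdeal : ∀ w e → lookup w e ≢ 0 → e S.∉ pathArcs → Poly.InInitialIdeal k n A c-path w
  nonPath-∈-initialIdeal w e wₑ≢0 e∉ = ∈-initialIdeal (unit e) (detour e) (sym (apply-detour e)) detour<unit w (unit-∣ᵐ w e wₑ≢0)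
    where
    ¬path : ¬ IsPath e
    ¬path = e∉ ∘ ∈-pathArcs⁺
    detour<unit : cost c-path (detour e) ℚ.< cost c-path (unit e)
    detour<unit = subst (ℚ._< cost c-path (unit e)) (sym (cost-pathOnly (detour e) (pathOnly-detour e)))
      (cost-positive (unit e) e (lookup-unit-≢0 e) ¬path)

  pathOnly-∉-initialIdeal : ∀ w → SuppIn w pathArcs → ¬ Poly.InInitialIdeal k n A c-path w
  pathOnly-∉-initialIdeal w w⊆ = ∉-initialIdeal w λ a u a+u≡w →
    pathOnly-optimal u (pathOnly-+ᵐ⁻ʳ a (subst PathOnly (sym a+u≡w) (λ e → ∈-pathArcs⁻ ∘ w⊆ e)))

theorem4p14 : ∀ {c ℓ : Level} (k : Field c ℓ) (d : ℕ) → 2 ≤ d →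
    let n = numArcs d
        A = incidence d
        J = λ (cv : Vec ℚ n) → Poly.InInitialIdeal k n A cv
    in (∃ λ (cv : Vec ℚ n) → Generic A cv × ArithDeg (J cv) 1)
       × (∀ (cv : Vec ℚ n) → Generic A cv → ∀ m → ArithDeg (J cv) m → 1 ≤ m)
theorem4p14 {c} {ℓ} k d _ =
    (c-path , generic , arithDeg-variableIdeal (J c-path) pathArcs nonPath-∈-initialIdeal pathOnly-∉-initialIdeal)
  , λ cv _ → arithDeg-positive (J cv) (PolynomialFacts.InitialIdeal.1∉initialIdeal k n A cv pointed)
  where
  open Tournament d
  open PathCost d
  open InitialIdealOfPathCost k d
  J : Vec ℚ n → Mon n → Set (c ⊔ ℓ)
  J = Poly.InInitialIdeal k n A
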